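{- Let $f$ be a polynomial vector field over a finite set $X$ and $\mathit{Query}, C\subseteq X\times X$. Then the procedure $\textsc{OnTheFly}(f,\mathit{Query},C)$ described below terminates (for any choice of the couplings it uses) and returns a relation $R\subseteq X\times X$ such that: (i) $R$ is a $C$-constrained backward differential bisimulation for $f$; (ii) for every $(x,y)\in\mathit{Query}$, $(x,y)\in R$ if and only if $(x,y)\in\mathtt{gfp}(\mathcal{B}^f_C)$.
   Context: Polynomial vector field: $f=(f_x)_{x\in X}$, each $f_x$ a real polynomial, i.e. a linear combination of distinct monomials $m=\prod_x x^{m(x)}$; $\mathbf{M}$ is the set of monomials. For linear combinations $g,h$ over a set $S$ (uniquely $g=g^+-g^-$, $g^\pm$ nonnegative with disjoint supports), a linear coupling is $\omega\colon S\times S\to\mathbb{R}_{\ge0}$ with $\sum_t\omega(s,t)=(g^++h^-)(s)$, $\sum_s\omega(s,t)=(h^++g^-)(t)$; $\Gamma_\mathbf{L}(g,h)$ is their set; for polynomials these are taken over $S=\mathbf{M}$. A monomial coupling for $(m,n)$ is $\rho\colon X\times X\to\mathbb{R}_{\ge0}$ with $\sum_y\rho(x,y)=m(x)$, $\sum_x\rho(x,y)=n(y)$; $\Gamma_\mathbf{M}(m,n)$ their set. $\mathit{supp}$ = pairs with positive value. $\mathbf{M}[R]$ = pairs of monomials with a monomial coupling supported in $R$; $\mathbf{P}[R]$ = pairs of polynomials with a linear coupling supported in $\mathbf{M}[R]$; $\mathcal{B}^f(R)=\{(x,y):(f_x,f_y)\in\mathbf{P}[R]\}$; $\mathcal{B}^f_C(R)=\mathcal{B}^f(R\setminus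 C)\setminus C$ (monotone), $\mathtt{gfp}$ its greatest fixed point over subsets of $X\times X$. A $C$-constrained BDB is $R$ with $R\subseteq\mathcal{B}^f(R)$ and $R\cap C=\emptyset$. Procedure $\textsc{OnTheFly}(f,\mathit{Query},C)$: initialize $R:=\mathit{Query}\setminus C$, $\hat R:=C$, $Q:=\emptyset$, $\hat Q:=\emptyset$ ($Q,\hat Q\subseteq\mathbf{M}\times\mathbf{M}$). Repeat the following body until an execution of it leaves $(R,\hat R,Q,\hat Q)$ unchanged: (a) for each $(x,y)\in R$: if some $\omega\in\Gamma_\mathbf{L}(f_x,f_y)$ has $\mathit{supp}(\omega)\cap\hat Q=\emptyset$, set $Q:=Q\cup\mathit{supp}(\omega)$ for one such $\omega$; otherwise move $(x,y)$ from $R$ to $\hat R$. (b) For each $(m,n)\in Q$: if some $\rho\in\Gamma_\mathbf{M}(m,n)$ has $\mathit{supp}(\rho)\cap\hat R=\emptyset$, set $R:=R\cup\mathit{supp}(\rho)$ for one such $\rho$; otherwise move $(m,n)$ from $Q$ to $\hat Q$. Finally return $R$. -}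

module Defs where

open import Level using (0ℓ)
open import Data.Nat as ℕ using (ℕ; zero; suc)
open import Data.Fin using (Fin)
open import Data.Vec using (Vec; lookup)
open import Data.Vec.Properties using (≡-dec)
open import Data.List using (List; []; _∷_)
open import Data.Maybe using (Maybe; just; nothing)
open import Data.Product using (Σ; Σ-syntax; ∃; _×_; _,_)
open import Data.Sum using (_⊎_; inj₁; inj₂)
open import Data.Empty using (⊥)
open import Relation.Nullary using (¬_; yes; no)
open import Relation.Binary.PropositionalEquality using (_≡_)
open import Function.Bundles using (_⇔_)

-- An axiomatic model of the real numbers: a Dedekind-complete ordered
-- field (with propositional equality).  The theorem is stated for every
-- such model.

record RealNumbers : Set₁ where
  infixl 6 _+_
  infixl 7 _*_
  infix  4 _≤_
  field
    ℝ   : Set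
    0# 1# : ℝ
    _+_ _*_ : ℝ → ℝ → ℝ
    -_  : ℝ → ℝ
    _≤_ : ℝ → ℝ → Set
    +-assoc     : ∀ x y z → (x + y) + z ≡ x + (y + z)
    +-comm      : ∀ x y → x + y ≡ y + x
    +-identityˡ : ∀ x → 0# + x ≡ x
    -‿inverseˡ  : ∀ x → (- x) + x ≡ 0#
    *-assoc     : ∀ x y z → (x * y) * z ≡ x * (y * z)
    *-comm      : ∀ x y → x * y ≡ y * x
    *-identityˡ : ∀ x → 1# * x ≡ x
    distribˡ    : ∀ x y z → x * (y + z) ≡ (x * y) + (x * z)
    0≢1         : ¬ (0# ≡ 1#)
    *-inverse   : ∀ x → ¬ (x ≡ 0#) → Σ[ y ∈ ℝ ] (y * x ≡ 1#)
    ≤-refl      : ∀ x → x ≤ x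
    ≤-antisym   : ∀ {x y} → x ≤ y → y ≤ x → x ≡ y
    ≤-trans     : ∀ {x y z} → x ≤ y → y ≤ z → x ≤ z
    ≤-total     : ∀ x y → (x ≤ y) ⊎ (y ≤ x)
    +-mono-≤    : ∀ {x y} z → x ≤ y → x + z ≤ y + z
    *-nonneg    : ∀ {x y} → 0# ≤ x → 0# ≤ y → 0# ≤ x * y
    sup : (P : ℝ → Set) → Σ ℝ P → Σ[ b ∈ ℝ ] (∀ x → P x → x ≤ b) →
          Σ[ s ∈ ℝ ] ((∀ x → P x → x ≤ s) ×
                      (∀ b → (∀ x → P x → x ≤ b) → s ≤ b))

  _<_ : ℝ → ℝ → Set
  x < y = (x ≤ y) × ¬ (x ≡ y)

  max : ℝ → ℝ → ℝ
  max x y with ≤-total x y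
  ... | inj₁ _ = y
  ... | inj₂ _ = x

  pos neg : ℝ → ℝ
  pos x = max x 0#
  neg x = max (- x) 0#

  fromℕ : ℕ → ℝ
  fromℕ zero    = 0#
  fromℕ (suc n) = 1# + fromℕ n

module Setting (𝓡 : RealNumbers) (k : ℕ) where
  open RealNumbers 𝓡

  X : Set
  X = Fin k

  RelX : Set₁
  RelX = X → X → Set

  -- monomials  m = ∏ₓ x^{m(x)} : exponent vectors
  Mono : Set
  Mono = Vec ℕ k

  RelM : Set₁
  RelM = Mono → Mono → Set

  Poly : Set
  Poly = List (ℝ × Mono)

  coeff : Poly → Mono → ℝ
  coeff [] m = 0#
  coeff ((c , n) ∷ p) m with ≡-dec ℕ._≟_ n m
  ... | yes _ = c + coeff p m
  ... | no  _ = coeff p m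

  -- finitely supported functions 𝐌 × 𝐌 → ℝ, as lists of entries
  MMFun : Set
  MMFun = List (Mono × Mono × ℝ)

  eval : MMFun → Mono → Mono → ℝ
  eval [] s t = 0#
  eval ((s' , t' , v) ∷ w) s t with ≡-dec ℕ._≟_ s' s | ≡-dec ℕ._≟_ t' t
  ... | yes _ | yes _ = v + eval w s t
  ... | _     | _     = eval w s t

  rowSum : MMFun → Mono → ℝ
  rowSum [] s = 0#
  rowSum ((s' , t' , v) ∷ w) s with ≡-dec ℕ._≟_ s' s
  ... | yes _ = v + rowSum w s
  ... | no  _ = rowSum w s

  colSum : MMFun → Mono → ℝ
  colSum [] t = 0#
  colSum ((s' , t' , v) ∷ w) t with ≡-dec ℕ._≟_ t' t
  ... | yes _ = v + colSum w t
  ... | no  _ = colSum w t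

  IsLinCoupling : Poly → Poly → MMFun → Set
  IsLinCoupling g h ω =
    (∀ s t → 0# ≤ eval ω s t) ×
    (∀ s → rowSum ω s ≡ pos (coeff g s) + neg (coeff h s)) ×
    (∀ t → colSum ω t ≡ pos (coeff h t) + neg (coeff g t))

  sumFin : ∀ {n} → (Fin n → ℝ) → ℝ
  sumFin {zero}  v = 0#
  sumFin {suc n} v = v Fin.zero + sumFin (λ i → v (Fin.suc i))

  IsMonCoupling : Mono → Mono → (X → X → ℝ) → Set
  IsMonCoupling m n ρ =
    (∀ x y → 0# ≤ ρ x y) ×
    (∀ x → sumFin (λ y → ρ x y) ≡ fromℕ (lookup m x)) ×
    (∀ y → sumFin (λ x → ρ x y) ≡ fromℕ (lookup n y))

  MonLift : RelX → RelM
  MonLift R m n = Σ[ ρ ∈ (X → X → ℝ) ]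
    (IsMonCoupling m n ρ × (∀ x y → 0# < ρ x y → R x y))

  PolyLift : RelX → Poly → Poly → Set
  PolyLift R g h = Σ[ ω ∈ MMFun ]
    (IsLinCoupling g h ω × (∀ s t → 0# < eval ω s t → MonLift R s t))

  module Field (f : X → Poly) where

    𝓑 : RelX → RelX
    𝓑 R x y = PolyLift R (f x) (f y)

    𝓑C : RelX → RelX → RelX
    𝓑C C R x y = 𝓑 (λ a b → R a b × ¬ C a b) x y × ¬ C x y

    -- greatest fixed point of the monotone map 𝓑^f_C
    -- (Knaster–Tarski: the union of all post-fixed points)
    gfp𝓑C : RelX → X → X → Set₁
    gfp𝓑C C x y = Σ[ R ∈ RelX ] ((∀ a b → R a b → 𝓑C C R a b) × R x y)

    IsConstrainedBDB : RelX → RelX → Set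
    IsConstrainedBDB C R =
      (∀ x y → R x y → 𝓑 R x y) × (∀ x y → R x y → ¬ C x y)

    -- The procedure OnTheFly, as a nondeterministic transition system.

    record State : Set₁ where
      constructor ⟨_,_,_,_⟩
      field
        R  : RelX
        R̂  : RelX
        Q  : RelM
        Q̂  : RelM
    open State public

    Same : State → State → Set
    Same s s' =
      (∀ x y → R s x y ⇔ R s' x y) × (∀ x y → R̂ s x y ⇔ R̂ s' x y) ×
      (∀ m n → Q s m n ⇔ Q s' m n) × (∀ m n → Q̂ s m n ⇔ Q̂ s' m n)

    Chosen : {A : Set} → (A → Set) → Maybe A → Set
    Chosen P (just a) = P a
    Chosen {A} P nothing = ¬ (Σ A P)

    OKa : State → X → X → MMFun → Set
    OKa s x y ω = IsLinCoupling (f x) (f y) ω ×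
                  (∀ m n → 0# < eval ω m n → ¬ Q̂ s m n)

    ValidA : State → (X → X → Maybe MMFun) → Set
    ValidA s ch = ∀ x y → R s x y → Chosen (OKa s x y) (ch x y)

    stepA : (X → X → Maybe MMFun) → State → State
    stepA ch s = ⟨ (λ x y → R s x y × Σ[ ω ∈ MMFun ] (ch x y ≡ just ω))
                 , (λ x y → R̂ s x y ⊎ (R s x y × ch x y ≡ nothing))
                 , (λ m n → Q s m n ⊎ Σ[ x ∈ X ] Σ[ y ∈ X ] Σ[ ω ∈ MMFun ]
                               (R s x y × ch x y ≡ just ω × 0# < eval ω m n))
                 , Q̂ s ⟩

    OKb : State → Mono → Mono → (X → X → ℝ) → Set
    OKb s m n ρ = IsMonCoupling m n ρ × (∀ x y → 0# < ρ x y → ¬ R̂ s x y)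

    ValidB : State → (Mono → Mono → Maybe (X → X → ℝ)) → Set
    ValidB s ch = ∀ m n → Q s m n → Chosen (OKb s m n) (ch m n)

    stepB : (Mono → Mono → Maybe (X → X → ℝ)) → State → State
    stepB ch s = ⟨ (λ x y → R s x y ⊎ Σ[ m ∈ Mono ] Σ[ n ∈ Mono ] Σ[ ρ ∈ (X → X → ℝ) ]
                               (Q s m n × ch m n ≡ just ρ × 0# < ρ x y))
                 , R̂ s
                 , (λ m n → Q s m n × Σ[ ρ ∈ (X → X → ℝ) ] (ch m n ≡ just ρ))
                 , (λ m n → Q̂ s m n ⊎ (Q s m n × ch m n ≡ nothing)) ⟩

    Body : State → State → Set
    Body s s' = Σ[ cha ∈ (X → X → Maybe MMFun) ] (ValidA s cha ×
                Σ[ chb ∈ (Mono → Mono → Maybe (X → X → ℝ)) ]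
                  (ValidB (stepA cha s) chb × Same s' (stepB chb (stepA cha s))))

    initial : RelX → RelX → State
    initial Query C = ⟨ (λ x y → Query x y × ¬ C x y) , C , (λ _ _ → ⊥) , (λ _ _ → ⊥) ⟩

    -- states reachable by executions of the body, each of which changed
    -- the state (so the loop did not yet stop)
    data Reach (s₀ : State) : State → Set₁ where
      start : Reach s₀ s₀
      next  : ∀ {s s'} → Reach s₀ s → Body s s' → ¬ Same s s' → Reach s₀ s'

    Terminates : RelX → RelX → Set₁
    Terminates Query C =
      ¬ (Σ[ σ ∈ (ℕ → State) ] (Same (σ 0) (initial Query C) ×
           (∀ i → Body (σ i) (σ (suc i)) × ¬ Same (σ i) (σ (suc i)))))

    -- every returned R (R of a reachable state whose next body execution
    -- leaves the state unchanged) has properties (i) and (ii)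
    Correct : RelX → RelX → Set₁
    Correct Query C = ∀ s s' → Reach (initial Query C) s → Body s s' → Same s s' →
      IsConstrainedBDB C (R s) ×
      (∀ x y → Query x y → (R s x y ⇔ gfp𝓑C C x y))

{-# OPTIONS --safe #-}
-- Every execution of the loop body only adds pairs to R ∪ R̂, R̂, Q ∪ Q̂ and Q̂, and all of them
-- range over the finite sets X × X and M × M, where M is the set of monomials occurring in f:
-- a linear coupling of f x and f y has vanishing marginals, hence vanishes, outside M.  As
-- R ∩ R̂ = Q ∩ Q̂ = ∅, an execution adding nothing changes nothing, so every run stops.
-- A pair enters R̂ (or Q̂) only when no post-fixed point of 𝓑C can contain (or lift) it, which
-- gives gfp ∩ Query ⊆ R; and when the body is stable, every pair of R has a coupling supported
-- in Q whose pairs have monomial couplings supported in R, so R is a C-constrained BDB.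
module Submission where

open import Defs
open import Data.Nat as ℕ using (ℕ; zero; suc; s≤s)
import Data.Nat.Properties as ℕₚ
open import Data.Fin using (Fin)
open import Data.Vec.Properties using (≡-dec)
open import Data.List using (List; []; _∷_; _++_; length; map; concatMap; allFin; cartesianProduct)
open import Data.List.Membership.Propositional using (_∈_)
open import Data.List.Membership.Propositional.Properties
  using (∈-++⁺ˡ; ∈-++⁺ʳ; ∈-map⁺; ∈-concatMap⁺; ∈-allFin; ∈-cartesianProduct⁺)
import Data.List.Membership.DecPropositional as DecMembership
open import Data.List.Relation.Unary.All using (All; []; _∷_; lookup)
import Data.List.Relation.Unary.Any as Any
open import Data.List.Relation.Unary.Any using (here; there)
open import Data.Maybe using (Maybe; just; nothing)
open import Data.Product using (Σ; _×_; _,_; proj₁; proj₂; uncurry)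
open import Data.Sum using (_⊎_; inj₁; inj₂; [_,_])
import Data.Sum as Sum
open import Data.Empty using (⊥; ⊥-elim)
open import Function using (id; _∘_)
open import Function.Bundles using (_⇔_; mk⇔; Equivalence)
open import Relation.Nullary using (¬_; yes; no)
open import Relation.Binary.PropositionalEquality
  using (_≡_; refl; sym; trans; cong; cong₂; subst; subst₂)

open Equivalence using (to; from)

no-infinite-ascent : ∀ {a} {A : Set a} (xs : List A) (P : ℕ → A → Set) →
  (∀ i x → P i x → P (suc i) x) → (∀ i → ¬ All (λ x → P (suc i) x → P i x) xs) → ⊥
no-infinite-ascent [] P ascending strict = strict 0 []
no-infinite-ascent (x ∷ xs) P ascending strict =
  no-infinite-ascent xs P ascending
    (λ i stable → strict i ((λ p → ⊥-elim (never (suc i) p)) ∷ stable))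
  where
  -- Once P i x holds it holds forever, so from i on the chain ascends strictly on xs alone.
  never : ∀ i → ¬ P i x
  never i p = no-infinite-ascent xs (λ j → P (j ℕ.+ i)) (λ j → ascending (j ℕ.+ i))
                (λ j stable → strict (j ℕ.+ i) ((λ _ → always j) ∷ stable))
    where
    always : ∀ j → P (j ℕ.+ i) x
    always zero    = p
    always (suc j) = ascending _ _ (always j)

disjoint-⊎-cancelʳ-⇔ : {A B A′ B′ : Set} → (A → ¬ B) → (A′ → ¬ B′) →
  ((A ⊎ B) ⇔ (A′ ⊎ B′)) → (B ⇔ B′) → A ⇔ A′
disjoint-⊎-cancelʳ-⇔ {A} {B} {A′} {B′} A∩B=∅ A′∩B′=∅ A⊎B⇔A′⊎B′ B⇔B′ = mk⇔ A⇒A′ A′⇒A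
  where
  A⇒A′ : A → A′
  A⇒A′ a = [ id , (λ b′ → ⊥-elim (A∩B=∅ a (from B⇔B′ b′))) ] (to A⊎B⇔A′⊎B′ (inj₁ a))
  A′⇒A : A′ → A
  A′⇒A a′ = [ id , (λ b → ⊥-elim (A′∩B′=∅ a′ (to B⇔B′ b))) ] (from A⊎B⇔A′⊎B′ (inj₁ a′))

module OrderedFieldProperties (𝓡 : RealNumbers) where
  open RealNumbers 𝓡

  +-identityʳ : ∀ x → x + 0# ≡ x
  +-identityʳ x = trans (+-comm x 0#) (+-identityˡ x)

  -0#≡0# : - 0# ≡ 0#
  -0#≡0# = trans (sym (+-identityʳ (- 0#))) (-‿inverseˡ 0#)

  x+[y+z]≡y+[x+z] : ∀ x y z → x + (y + z) ≡ y + (x + z)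
  x+[y+z]≡y+[x+z] x y z =
    trans (sym (+-assoc x y z)) (trans (cong (_+ z) (+-comm x y)) (+-assoc y x z))

  max-idem : ∀ x → max x x ≡ x
  max-idem x with ≤-total x x
  ... | inj₁ _ = refl
  ... | inj₂ _ = refl

  pos+neg≡0# : ∀ {x y} → x ≡ 0# → y ≡ 0# → pos x + neg y ≡ 0#
  pos+neg≡0# refl refl =
    trans (cong₂ _+_ (max-idem 0#) (trans (cong (λ z → max z 0#) -0#≡0#) (max-idem 0#)))
          (+-identityˡ 0#)

  x≤x+y : ∀ x {y} → 0# ≤ y → x ≤ x + y
  x≤x+y x {y} 0≤y = subst₂ _≤_ (+-identityˡ x) (+-comm y x) (+-mono-≤ x 0≤y)

  +-nonneg : ∀ {x y} → 0# ≤ x → 0# ≤ y → 0# ≤ x + y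
  +-nonneg {x} 0≤x 0≤y = ≤-trans 0≤x (x≤x+y x 0≤y)

  <⇒≱ : ∀ {x y} → x < y → ¬ y ≤ x
  <⇒≱ (x≤y , x≢y) y≤x = x≢y (≤-antisym x≤y y≤x)

module Couplings (𝓡 : RealNumbers) (k : ℕ) where
  open RealNumbers 𝓡
  open Setting 𝓡 k
  open OrderedFieldProperties 𝓡

  eval-∷-≢ʳ : ∀ s′ {t′} v ω s {t} → ¬ t′ ≡ t → eval ((s′ , t′ , v) ∷ ω) s t ≡ eval ω s t
  eval-∷-≢ʳ s′ {t′} v ω s {t} t′≢t with ≡-dec ℕ._≟_ s′ s | ≡-dec ℕ._≟_ t′ t
  ... | _     | yes t′≡t = ⊥-elim (t′≢t t′≡t)
  ... | yes _ | no _     = refl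
  ... | no _  | no _     = refl

  dropColumn : Mono → MMFun → MMFun
  dropColumn t [] = []
  dropColumn t ((s′ , t′ , v) ∷ ω) with ≡-dec ℕ._≟_ t′ t
  ... | yes _ = dropColumn t ω
  ... | no  _ = (s′ , t′ , v) ∷ dropColumn t ω

  eval-dropColumn-≡ : ∀ ω s t → eval (dropColumn t ω) s t ≡ 0#
  eval-dropColumn-≡ [] s t = refl
  eval-dropColumn-≡ ((s′ , t′ , v) ∷ ω) s t with ≡-dec ℕ._≟_ t′ t
  ... | yes _    = eval-dropColumn-≡ ω s t
  ... | no t′≢t = trans (eval-∷-≢ʳ s′ v (dropColumn t ω) s t′≢t) (eval-dropColumn-≡ ω s t)

  eval-dropColumn-≢ : ∀ ω s {t u} → ¬ u ≡ t → eval (dropColumn t ω) s u ≡ eval ω s u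
  eval-dropColumn-≢ [] s u≢t = refl
  eval-dropColumn-≢ ((s′ , t′ , v) ∷ ω) s {t} {u} u≢t with ≡-dec ℕ._≟_ t′ t
  ... | yes t′≡t = trans (eval-dropColumn-≢ ω s u≢t)
                         (sym (eval-∷-≢ʳ s′ v ω s (λ t′≡u → u≢t (trans (sym t′≡u) t′≡t))))
  ... | no _ with ≡-dec ℕ._≟_ s′ s | ≡-dec ℕ._≟_ t′ u
  ...   | yes _ | yes _ = cong (v +_) (eval-dropColumn-≢ ω s u≢t)
  ...   | yes _ | no _  = eval-dropColumn-≢ ω s u≢t
  ...   | no _  | _     = eval-dropColumn-≢ ω s u≢t

  rowSum-dropColumn : ∀ ω s t → rowSum ω s ≡ eval ω s t + rowSum (dropColumn t ω) s
  rowSum-dropColumn [] s t = sym (+-identityˡ 0#)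
  rowSum-dropColumn ((s′ , t′ , v) ∷ ω) s t with ≡-dec ℕ._≟_ t′ t
  ... | yes t′≡t with ≡-dec ℕ._≟_ s′ s | ≡-dec ℕ._≟_ t′ t
  ...   | yes _ | yes _    = trans (cong (v +_) (rowSum-dropColumn ω s t)) (sym (+-assoc v _ _))
  ...   | yes _ | no t′≢t = ⊥-elim (t′≢t t′≡t)
  ...   | no _  | _        = rowSum-dropColumn ω s t
  rowSum-dropColumn ((s′ , t′ , v) ∷ ω) s t | no t′≢t with ≡-dec ℕ._≟_ s′ s | ≡-dec ℕ._≟_ t′ t
  ...   | _     | yes t′≡t = ⊥-elim (t′≢t t′≡t)
  ...   | yes _ | no _     = trans (cong (v +_) (rowSum-dropColumn ω s t)) (x+[y+z]≡y+[x+z] v _ _)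
  ...   | no _  | no _     = rowSum-dropColumn ω s t

  length-dropColumn : ∀ t ω → length (dropColumn t ω) ℕ.≤ length ω
  length-dropColumn t [] = ℕ.z≤n
  length-dropColumn t ((s′ , t′ , v) ∷ ω) with ≡-dec ℕ._≟_ t′ t
  ... | yes _ = ℕₚ.m≤n⇒m≤1+n (length-dropColumn t ω)
  ... | no _  = s≤s (length-dropColumn t ω)

  length-dropColumn-head : ∀ s t v ω → length (dropColumn t ((s , t , v) ∷ ω)) ℕ.≤ length ω
  length-dropColumn-head s t v ω with ≡-dec ℕ._≟_ t t
  ... | yes _  = length-dropColumn t ω
  ... | no t≢t = ⊥-elim (t≢t refl)

  dropColumn-nonneg : ∀ ω s t → (∀ u → 0# ≤ eval ω s u) → ∀ u → 0# ≤ eval (dropColumn t ω) s u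
  dropColumn-nonneg ω s t nonneg u with ≡-dec ℕ._≟_ u t
  ... | yes refl = subst (0# ≤_) (sym (eval-dropColumn-≡ ω s u)) (≤-refl 0#)
  ... | no u≢t   = subst (0# ≤_) (sym (eval-dropColumn-≢ ω s u≢t)) (nonneg u)

  -- Entries of ω may be negative; only their sums per cell are not, so we sum cell by cell.
  rowSum-nonneg : ∀ ω s → (∀ t → 0# ≤ eval ω s t) → 0# ≤ rowSum ω s
  rowSum-nonneg ω s = bounded (length ω) ω ℕₚ.≤-refl
    where
    bounded : ∀ n ω → length ω ℕ.≤ n → (∀ t → 0# ≤ eval ω s t) → 0# ≤ rowSum ω s
    bounded _ [] _ _ = ≤-refl 0#
    bounded (suc n) ω@((s′ , t′ , v) ∷ ω′) (s≤s |ω′|≤n) nonneg =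
      subst (0# ≤_) (sym (rowSum-dropColumn ω s t′))
        (+-nonneg (nonneg t′)
          (bounded n (dropColumn t′ ω) (ℕₚ.≤-trans (length-dropColumn-head s′ t′ v ω′) |ω′|≤n)
            (dropColumn-nonneg ω s t′ nonneg)))

  eval≤rowSum : ∀ ω s t → (∀ u → 0# ≤ eval ω s u) → eval ω s t ≤ rowSum ω s
  eval≤rowSum ω s t nonneg =
    subst (eval ω s t ≤_) (sym (rowSum-dropColumn ω s t))
      (x≤x+y (eval ω s t) (rowSum-nonneg (dropColumn t ω) s (dropColumn-nonneg ω s t nonneg)))

  transpose : MMFun → MMFun
  transpose [] = []
  transpose ((s , t , v) ∷ ω) = (t , s , v) ∷ transpose ω

  eval-transpose : ∀ ω s t → eval (transpose ω) s t ≡ eval ω t s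
  eval-transpose [] s t = refl
  eval-transpose ((s′ , t′ , v) ∷ ω) s t with ≡-dec ℕ._≟_ s′ t | ≡-dec ℕ._≟_ t′ s
  ... | yes _ | yes _ = cong (v +_) (eval-transpose ω s t)
  ... | yes _ | no _  = eval-transpose ω s t
  ... | no _  | yes _ = eval-transpose ω s t
  ... | no _  | no _  = eval-transpose ω s t

  rowSum-transpose : ∀ ω s → rowSum (transpose ω) s ≡ colSum ω s
  rowSum-transpose [] s = refl
  rowSum-transpose ((s′ , t′ , v) ∷ ω) s with ≡-dec ℕ._≟_ t′ s
  ... | yes _ = cong (v +_) (rowSum-transpose ω s)
  ... | no _  = rowSum-transpose ω s

  colSum-transpose : ∀ ω t → colSum (transpose ω) t ≡ rowSum ω t
  colSum-transpose [] t = refl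
  colSum-transpose ((s′ , t′ , v) ∷ ω) t with ≡-dec ℕ._≟_ s′ t
  ... | yes _ = cong (v +_) (colSum-transpose ω t)
  ... | no _  = colSum-transpose ω t

  transpose-isLinCoupling : ∀ {g h ω} → IsLinCoupling g h ω → IsLinCoupling h g (transpose ω)
  transpose-isLinCoupling {ω = ω} (nonneg , rows , cols) =
    (λ s t → subst (0# ≤_) (sym (eval-transpose ω s t)) (nonneg t s)) ,
    (λ s → trans (rowSum-transpose ω s) (cols s)) ,
    (λ t → trans (colSum-transpose ω t) (rows t))

  coeff-∉ : ∀ p {m} → ¬ m ∈ map proj₂ p → coeff p m ≡ 0#
  coeff-∉ [] m∉ = refl
  coeff-∉ ((c , n) ∷ p) {m} m∉ with ≡-dec ℕ._≟_ n m
  ... | yes n≡m = ⊥-elim (m∉ (here (sym n≡m)))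
  ... | no _    = coeff-∉ p (λ m∈ → m∉ (there m∈))

  coupling-row-support : ∀ g h ω s t → IsLinCoupling g h ω → 0# < eval ω s t →
    coeff g s ≡ 0# → coeff h s ≡ 0# → ⊥
  coupling-row-support g h ω s t (nonneg , rows , _) 0<ω g≡0 h≡0 =
    <⇒≱ 0<ω (subst (eval ω s t ≤_) (trans (rows s) (pos+neg≡0# g≡0 h≡0))
                   (eval≤rowSum ω s t (nonneg s)))

  coupling-column-support : ∀ g h ω s t → IsLinCoupling g h ω → 0# < eval ω s t →
    coeff g t ≡ 0# → coeff h t ≡ 0# → ⊥
  coupling-column-support g h ω s t coupling 0<ω g≡0 h≡0 =
    coupling-row-support h g (transpose ω) t s (transpose-isLinCoupling {g} {h} {ω} coupling)
      (subst (0# <_) (sym (eval-transpose ω t s)) 0<ω) h≡0 g≡0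

module Liftings (𝓡 : RealNumbers) (k : ℕ) where
  open Setting 𝓡 k

  MonLift-mono : ∀ {S T : RelX} → (∀ x y → S x y → T x y) → ∀ m n → MonLift S m n → MonLift T m n
  MonLift-mono S⊆T m n (ρ , coupling , supp⊆S) = ρ , coupling , λ x y 0<ρ → S⊆T x y (supp⊆S x y 0<ρ)

  PolyLift-mono : ∀ {S T : RelX} → (∀ x y → S x y → T x y) → ∀ g h → PolyLift S g h → PolyLift T g h
  PolyLift-mono S⊆T g h (ω , coupling , supp⊆S) =
    ω , coupling , λ m n 0<ω → MonLift-mono S⊆T m n (supp⊆S m n 0<ω)

module OnTheFly (𝓡 : RealNumbers) (k : ℕ) (f : Fin k → Setting.Poly 𝓡 k) where
  open RealNumbers 𝓡
  open Setting 𝓡 k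
  open Field f
  open Couplings 𝓡 k
  open Liftings 𝓡 k
  open DecMembership (≡-dec {n = k} ℕ._≟_) using (_∈?_)

  monomials : List Mono
  monomials = concatMap (λ z → map proj₂ (f z)) (allFin k)

  coeff-∉monomials : ∀ {m} → ¬ m ∈ monomials → ∀ z → coeff (f z) m ≡ 0#
  coeff-∉monomials m∉ z = coeff-∉ (f z) λ m∈ →
    m∉ (∈-concatMap⁺ (λ z → map proj₂ (f z)) (Any.map (λ { refl → m∈ }) (∈-allFin z)))

  coupling-support⊆monomials : ∀ x y ω m n → IsLinCoupling (f x) (f y) ω → 0# < eval ω m n →
    m ∈ monomials × n ∈ monomials
  coupling-support⊆monomials x y ω m n coupling 0<ω = m∈ , n∈
    where
    m∈ : m ∈ monomials
    m∈ with m ∈? monomials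
    ... | yes m∈ = m∈
    ... | no m∉  = ⊥-elim (coupling-row-support (f x) (f y) ω m n coupling 0<ω
                             (coeff-∉monomials m∉ x) (coeff-∉monomials m∉ y))
    n∈ : n ∈ monomials
    n∈ with n ∈? monomials
    ... | yes n∈ = n∈
    ... | no n∉  = ⊥-elim (coupling-column-support (f x) (f y) ω m n coupling 0<ω
                             (coeff-∉monomials n∉ x) (coeff-∉monomials n∉ y))

  chosen-just : ∀ {A : Set} {P : A → Set} {c a} → Chosen P c → c ≡ just a → P a
  chosen-just p refl = p

  chosen-nothing : ∀ {A : Set} {P : A → Set} {c} → Chosen P c → c ≡ nothing → ¬ Σ A P
  chosen-nothing ¬p refl = ¬p

  just≢nothing : ∀ {A : Set} {c : Maybe A} {a} → c ≡ just a → c ≡ nothing → ⊥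
  just≢nothing refl ()

  PostFixed : RelX → RelX → Set
  PostFixed C S = ∀ x y → S x y → 𝓑C C S x y

  constrainedBDB⇒postFixed : ∀ {C S} → IsConstrainedBDB C S → PostFixed C S
  constrainedBDB⇒postFixed {C} {S} (S⊆𝓑S , S∩C=∅) x y s =
    PolyLift-mono (λ a b s′ → s′ , S∩C=∅ a b s′) (f x) (f y) (S⊆𝓑S x y s) , S∩C=∅ x y s

  record Invariant (Query C : RelX) (s : State) : Set₁ where
    field
      R-disjoint-R̂ : ∀ x y → R s x y → ¬ R̂ s x y
      C⊆R̂ : ∀ x y → C x y → R̂ s x y
      R̂-refuted : ∀ x y → R̂ s x y → ∀ S → PostFixed C S → ¬ S x y
      Q̂-refuted : ∀ m n → Q̂ s m n → ∀ S → PostFixed C S → ¬ MonLift S m n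
      Query⊆R∪R̂ : ∀ x y → Query x y → ¬ C x y → R s x y ⊎ R̂ s x y
      Q-disjoint-Q̂ : ∀ m n → Q s m n → ¬ Q̂ s m n
      Q⊆monomials : ∀ m n → Q s m n → m ∈ monomials × n ∈ monomials
      Q̂⊆monomials : ∀ m n → Q̂ s m n → m ∈ monomials × n ∈ monomials
  open Invariant

  module _ {Query C : RelX} where

    invariant-initial : Invariant Query C (initial Query C)
    invariant-initial = record
      { R-disjoint-R̂ = λ _ _ (_ , ¬c) c → ¬c c
      ; C⊆R̂          = λ _ _ c → c
      ; R̂-refuted    = λ x y c S post s → proj₂ (post x y s) c
      ; Q̂-refuted    = λ _ _ ()
      ; Query⊆R∪R̂   = λ _ _ q ¬c → inj₁ (q , ¬c)
      ; Q-disjoint-Q̂ = λ _ _ ()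
      ; Q⊆monomials  = λ _ _ ()
      ; Q̂⊆monomials  = λ _ _ () }

    invariant-stepA : ∀ {s chA} → Invariant Query C s → ValidA s chA →
                      Invariant Query C (stepA chA s)
    invariant-stepA {s} {chA} I validA = record
      { R-disjoint-R̂ = λ { x y (r , _) (inj₁ r̂) → R-disjoint-R̂ I x y r r̂
                         ; x y (_ , _ , some) (inj₂ (_ , none)) → just≢nothing some none }
      ; C⊆R̂          = λ x y c → inj₁ (C⊆R̂ I x y c)
      ; R̂-refuted    = λ { x y (inj₁ r̂) → R̂-refuted I x y r̂
                         ; x y (inj₂ (r , none)) → dropped-refuted r none }
      ; Q̂-refuted    = Q̂-refuted I
      ; Query⊆R∪R̂   = query-kept
      ; Q-disjoint-Q̂ = λ { m n (inj₁ q) → Q-disjoint-Q̂ I m n q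
                         ; m n (inj₂ (x , y , ω , r , some , 0<ω)) →
                             proj₂ (chosen-just (validA x y r) some) m n 0<ω }
      ; Q⊆monomials  = λ { m n (inj₁ q) → Q⊆monomials I m n q
                         ; m n (inj₂ (x , y , ω , r , some , 0<ω)) →
                             coupling-support⊆monomials x y ω m n
                               (proj₁ (chosen-just (validA x y r) some)) 0<ω }
      ; Q̂⊆monomials  = Q̂⊆monomials I }
      where
      -- A post-fixed point through (x, y) yields a coupling of f x, f y avoiding Q̂,
      -- so one was available.
      dropped-refuted : ∀ {x y} → R s x y → chA x y ≡ nothing → ∀ S → PostFixed C S → ¬ S x y
      dropped-refuted {x} {y} r none S post sxy with proj₁ (post x y sxy)
      ... | ω , coupling , lifts = chosen-nothing (validA x y r) none
              (ω , coupling , λ m n 0<ω q̂ →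
                 Q̂-refuted I m n q̂ S post (MonLift-mono (λ _ _ → proj₁) m n (lifts m n 0<ω)))
      query-kept : ∀ x y → Query x y → ¬ C x y → R (stepA chA s) x y ⊎ R̂ (stepA chA s) x y
      query-kept x y q ¬c with Query⊆R∪R̂ I x y q ¬c
      ... | inj₂ r̂ = inj₂ (inj₁ r̂)
      ... | inj₁ r with chA x y
      ...   | just ω  = inj₁ (r , ω , refl)
      ...   | nothing = inj₂ (inj₂ (r , refl))

    invariant-stepB : ∀ {s chB} → Invariant Query C s → ValidB s chB →
                      Invariant Query C (stepB chB s)
    invariant-stepB {s} {chB} I validB = record
      { R-disjoint-R̂ = λ { x y (inj₁ r) r̂ → R-disjoint-R̂ I x y r r̂
                         ; x y (inj₂ (m , n , ρ , q , some , 0<ρ)) →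
                             proj₂ (chosen-just (validB m n q) some) x y 0<ρ }
      ; C⊆R̂          = C⊆R̂ I
      ; R̂-refuted    = R̂-refuted I
      ; Q̂-refuted    = λ { m n (inj₁ q̂) → Q̂-refuted I m n q̂
                         ; m n (inj₂ (q , none)) → dropped-refuted q none }
      ; Query⊆R∪R̂   = λ x y q ¬c → Sum.map₁ inj₁ (Query⊆R∪R̂ I x y q ¬c)
      ; Q-disjoint-Q̂ = λ { m n (q , _) (inj₁ q̂) → Q-disjoint-Q̂ I m n q q̂
                         ; m n (_ , _ , some) (inj₂ (_ , none)) → just≢nothing some none }
      ; Q⊆monomials  = λ m n (q , _) → Q⊆monomials I m n q
      ; Q̂⊆monomials  = λ { m n (inj₁ q̂) → Q̂⊆monomials I m n q̂
                         ; m n (inj₂ (q , _)) → Q⊆monomials I m n q } }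
      where
      -- A lifting into a post-fixed point is a monomial coupling avoiding R̂, so one was available.
      dropped-refuted : ∀ {m n} → Q s m n → chB m n ≡ nothing →
                        ∀ S → PostFixed C S → ¬ MonLift S m n
      dropped-refuted {m} {n} q none S post (ρ , coupling , supp⊆S) =
        chosen-nothing (validB m n q) none
          (ρ , coupling , λ x y 0<ρ r̂ → R̂-refuted I x y r̂ S post (supp⊆S x y 0<ρ))

    invariant-same : ∀ {s t} → Invariant Query C t → Same s t → Invariant Query C s
    invariant-same I (R≈ , R̂≈ , Q≈ , Q̂≈) = record
      { R-disjoint-R̂ = λ x y r r̂ → R-disjoint-R̂ I x y (to (R≈ x y) r) (to (R̂≈ x y) r̂)
      ; C⊆R̂          = λ x y c → from (R̂≈ x y) (C⊆R̂ I x y c)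
      ; R̂-refuted    = λ x y r̂ → R̂-refuted I x y (to (R̂≈ x y) r̂)
      ; Q̂-refuted    = λ m n q̂ → Q̂-refuted I m n (to (Q̂≈ m n) q̂)
      ; Query⊆R∪R̂   = λ x y q ¬c → Sum.map (from (R≈ x y)) (from (R̂≈ x y)) (Query⊆R∪R̂ I x y q ¬c)
      ; Q-disjoint-Q̂ = λ m n q q̂ → Q-disjoint-Q̂ I m n (to (Q≈ m n) q) (to (Q̂≈ m n) q̂)
      ; Q⊆monomials  = λ m n q → Q⊆monomials I m n (to (Q≈ m n) q)
      ; Q̂⊆monomials  = λ m n q̂ → Q̂⊆monomials I m n (to (Q̂≈ m n) q̂) }

    invariant-body : ∀ {s s′} → Invariant Query C s → Body s s′ → Invariant Query C s′
    invariant-body I (_ , validA , _ , validB , s′≈step) =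
      invariant-same (invariant-stepB (invariant-stepA I validA) validB) s′≈step

    invariant-reach : ∀ {s} → Reach (initial Query C) s → Invariant Query C s
    invariant-reach start               = invariant-initial
    invariant-reach (next reach body _) = invariant-body (invariant-reach reach) body

  data Observation : Set where
    visited  refuted  : X → X → Observation
    visitedₘ refutedₘ : Mono → Mono → Observation

  Holds : State → Observation → Set
  Holds s (visited x y)  = R s x y ⊎ R̂ s x y
  Holds s (refuted x y)  = R̂ s x y
  Holds s (visitedₘ m n) = Q s m n ⊎ Q̂ s m n
  Holds s (refutedₘ m n) = Q̂ s m n

  Grows : State → State → Set
  Grows s s′ = ∀ o → Holds s o → Holds s′ o

  body-grows : ∀ {s s′} → Body s s′ → Grows s s′
  body-grows {s} {s′} (chA , _ , chB , _ , R≈ , R̂≈ , Q≈ , Q̂≈) = grows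
    where
    grows : Grows s s′
    grows (visited x y) (inj₂ r̂) = inj₂ (from (R̂≈ x y) (inj₁ r̂))
    grows (visited x y) (inj₁ r) with chA x y in chosen
    ... | just ω  = inj₁ (from (R≈ x y) (inj₁ (r , ω , chosen)))
    ... | nothing = inj₂ (from (R̂≈ x y) (inj₂ (r , chosen)))
    grows (refuted x y) r̂ = from (R̂≈ x y) (inj₁ r̂)
    grows (visitedₘ m n) (inj₂ q̂) = inj₂ (from (Q̂≈ m n) (inj₁ q̂))
    grows (visitedₘ m n) (inj₁ q) with chB m n in chosen
    ... | just ρ  = inj₁ (from (Q≈ m n) (inj₁ q , ρ , chosen))
    ... | nothing = inj₂ (from (Q̂≈ m n) (inj₂ (inj₁ q , chosen)))
    grows (refutedₘ m n) q̂ = from (Q̂≈ m n) (inj₁ q̂)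

  variablePairs : List (X × X)
  variablePairs = cartesianProduct (allFin k) (allFin k)

  monomialPairs : List (Mono × Mono)
  monomialPairs = cartesianProduct monomials monomials

  variableObservations : List Observation
  variableObservations = map (uncurry visited) variablePairs ++ map (uncurry refuted) variablePairs

  monomialObservations : List Observation
  monomialObservations =
    map (uncurry visitedₘ) monomialPairs ++ map (uncurry refutedₘ) monomialPairs

  observations : List Observation
  observations = variableObservations ++ monomialObservations

  visited∈observations : ∀ x y → visited x y ∈ observations
  visited∈observations x y = ∈-++⁺ˡ (∈-++⁺ˡ
    (∈-map⁺ (uncurry visited) (∈-cartesianProduct⁺ (∈-allFin x) (∈-allFin y))))

  refuted∈observations : ∀ x y → refuted x y ∈ observations
  refuted∈observations x y = ∈-++⁺ˡ (∈-++⁺ʳ (map (uncurry visited) variablePairs)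
    (∈-map⁺ (uncurry refuted) (∈-cartesianProduct⁺ (∈-allFin x) (∈-allFin y))))

  visitedₘ∈observations : ∀ {m n} → m ∈ monomials × n ∈ monomials → visitedₘ m n ∈ observations
  visitedₘ∈observations (m∈ , n∈) = ∈-++⁺ʳ variableObservations (∈-++⁺ˡ
    (∈-map⁺ (uncurry visitedₘ) (∈-cartesianProduct⁺ m∈ n∈)))

  refutedₘ∈observations : ∀ {m n} → m ∈ monomials × n ∈ monomials → refutedₘ m n ∈ observations
  refutedₘ∈observations (m∈ , n∈) =
    ∈-++⁺ʳ variableObservations (∈-++⁺ʳ (map (uncurry visitedₘ) monomialPairs)
      (∈-map⁺ (uncurry refutedₘ) (∈-cartesianProduct⁺ m∈ n∈)))

  stable⇒same : ∀ {Query C s s′} → Invariant Query C s → Invariant Query C s′ → Grows s s′ →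
    All (λ o → Holds s′ o → Holds s o) observations → Same s s′
  stable⇒same {s = s} {s′} I I′ grows stable = R≈ , R̂≈ , Q≈ , Q̂≈
    where
    back : ∀ {o} → o ∈ observations → Holds s′ o → Holds s o
    back = lookup stable
    R̂≈ : ∀ x y → R̂ s x y ⇔ R̂ s′ x y
    R̂≈ x y = mk⇔ (grows (refuted x y)) (back (refuted∈observations x y))
    R≈ : ∀ x y → R s x y ⇔ R s′ x y
    R≈ x y = disjoint-⊎-cancelʳ-⇔ (R-disjoint-R̂ I x y) (R-disjoint-R̂ I′ x y)
      (mk⇔ (grows (visited x y)) (back (visited∈observations x y))) (R̂≈ x y)
    Q̂≈ : ∀ m n → Q̂ s m n ⇔ Q̂ s′ m n
    Q̂≈ m n = mk⇔ (grows (refutedₘ m n))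
      (λ q̂ → back (refutedₘ∈observations (Q̂⊆monomials I′ m n q̂)) q̂)
    Q≈ : ∀ m n → Q s m n ⇔ Q s′ m n
    Q≈ m n = disjoint-⊎-cancelʳ-⇔ (Q-disjoint-Q̂ I m n) (Q-disjoint-Q̂ I′ m n)
      (mk⇔ (grows (visitedₘ m n))
           (λ q → back (visitedₘ∈observations ([ Q⊆monomials I′ m n , Q̂⊆monomials I′ m n ] q)) q))
      (Q̂≈ m n)

  terminates : ∀ {Query C} → Terminates Query C
  terminates {Query} {C} (σ , σ₀≈initial , steps) =
    no-infinite-ascent observations (λ i → Holds (σ i)) (λ i → body-grows (proj₁ (steps i)))
      (λ i stable → proj₂ (steps i)
        (stable⇒same (invariant i) (invariant (suc i)) (body-grows (proj₁ (steps i))) stable))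
    where
    invariant : ∀ i → Invariant Query C (σ i)
    invariant zero    = invariant-same invariant-initial σ₀≈initial
    invariant (suc i) = invariant-body (invariant i) (proj₁ (steps i))

  module _ {Query C : RelX} {s : State} (I : Invariant Query C s) where

    stable⇒constrainedBDB : ∀ {s′} → Body s s′ → Same s s′ → IsConstrainedBDB C (R s)
    stable⇒constrainedBDB (chA , validA , chB , validB , R′≈ , R̂′≈ , _ , Q̂′≈)
                          (R≈ , R̂≈ , _ , Q̂≈) =
      R⊆𝓑R , λ x y r c → R-disjoint-R̂ I x y r (C⊆R̂ I x y c)
      where
      after : State
      after = stepB chB (stepA chA s)
      R-after : ∀ x y → R after x y → R s x y
      R-after x y = from (R≈ x y) ∘ from (R′≈ x y)
      R̂-after : ∀ x y → R̂ after x y → R̂ s x y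
      R̂-after x y = from (R̂≈ x y) ∘ from (R̂′≈ x y)
      Q̂-after : ∀ m n → Q̂ after m n → Q̂ s m n
      Q̂-after m n = from (Q̂≈ m n) ∘ from (Q̂′≈ m n)
      -- An unchosen pair would have moved into R̂ (resp. Q̂), which the stable body leaves
      -- unchanged.
      R⊆𝓑R : ∀ x y → R s x y → 𝓑 (R s) x y
      R⊆𝓑R x y r with chA x y in chosenA
      ... | nothing = ⊥-elim (R-disjoint-R̂ I x y r (R̂-after x y (inj₂ (r , chosenA))))
      ... | just ω  = ω , proj₁ okA , lifts
        where
        okA : OKa s x y ω
        okA = chosen-just (validA x y r) chosenA
        queued : ∀ m n → 0# < eval ω m n → Q (stepA chA s) m n
        queued m n 0<ω = inj₂ (x , y , ω , r , chosenA , 0<ω)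
        lifts : ∀ m n → 0# < eval ω m n → MonLift (R s) m n
        lifts m n 0<ω with chB m n in chosenB
        ... | nothing = ⊥-elim (proj₂ okA m n 0<ω (Q̂-after m n (inj₂ (queued m n 0<ω , chosenB))))
        ... | just ρ  = ρ , proj₁ (chosen-just (validB m n (queued m n 0<ω)) chosenB) ,
                        λ a b 0<ρ → R-after a b (inj₂ (m , n , ρ , queued m n 0<ω , chosenB , 0<ρ))

    gfp⇒R : ∀ x y → Query x y → gfp𝓑C C x y → R s x y
    gfp⇒R x y q (S , post , sxy) =
      [ id , (λ r̂ → ⊥-elim (R̂-refuted I x y r̂ S post sxy)) ]
        (Query⊆R∪R̂ I x y q (proj₂ (post x y sxy)))

  correct : ∀ {Query C} → Correct Query C
  correct {Query} {C} s s′ reach body s≈s′ =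
    bdb , λ x y q → mk⇔ (λ r → R s , constrainedBDB⇒postFixed bdb , r) (gfp⇒R I x y q)
    where
    I : Invariant Query C s
    I = invariant-reach reach
    bdb : IsConstrainedBDB C (R s)
    bdb = stable⇒constrainedBDB I body s≈s′

theorem7 : (𝓡 : RealNumbers) (k : ℕ) (f : Fin k → Setting.Poly 𝓡 k)
    (Query C : Fin k → Fin k → Set) →
    Setting.Field.Terminates 𝓡 k f Query C × Setting.Field.Correct 𝓡 k f Query C
theorem7 𝓡 k f Query C = OnTheFly.terminates 𝓡 k f , OnTheFly.correct 𝓡 k f
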